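{- Let $v,w\in S_n$ with $I(v)=(x_1,\ldots,x_n)$ and $I(w)=(y_1,\ldots,y_n)$. In the middle order lattice $\mathcal{P}_n$, the relative pseudocomplement satisfies $I(v\rightsquigarrow w)=(z_1,\ldots,z_n)$ where $z_i=i-1$ if $x_i\le y_i$ and $z_i=y_i$ if $x_i>y_i$. As a consequence, the pseudocomplement $\sim v$ is the $132$- and $231$-avoiding permutation obtained by listing the right-to-left minima of $v$ in decreasing order, followed by all the remaining values in increasing order. Finally, $v$ is regular if and only if $v$ avoids both $132$ and $231$.
   Context: For $w\in S_n$ (one-line notation), its inversion sequence is $I(w)=(x_1,\ldots,x_n)$ with $x_i=\#\{j<i : w^{ -1}(j)>w^{ -1}(i)\}$; $w\mapsto I(w)$ is a bijection onto sequences with $x_i\in[0,i-1]$. The middle order $\mathcal{P}_n$ is the lattice on $S_n$ with $v\le w$ iff $I(v)\le I(w)$ coordinate-wise; meet and join are coordinate-wise min and max of inversion sequences, and its minimum is the identity $e_n$. The relative pseudocomplement is $v\rightsquigarrow w=\max\{z\in\mathcal{P}_n : v\wedge z\le w\}$, the pseudocomplement is $\sim v=v\rightsquigarrow e_n$, and $v$ is regular if $v=\sim\sim v$. A right-to-left minimum of $v$ is a value $i$ such that no smaller value appears to its right in $v$. A permutation avoids $132$ (resp. $231$) if it has no indices $i<j<k$ with $w(i)<w(k)<w(j)$ (resp. $w(k)<w(i)<w(j)$). -}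

module Defs where

open import Data.Nat as ℕ using (ℕ)
open import Data.Fin as Fin using (Fin; toℕ)
open import Data.Fin.Properties using (all?; _<?_)
open import Data.Fin.Permutation using (Permutation′; _⟨$⟩ʳ_; _⟨$⟩ˡ_; _≈_)
import Data.Fin.Permutation as Perm
open import Data.List using (List; length; filter; reverse; map; _++_; allFin)
open import Data.Product using (_×_; ∃; ∃-syntax; Σ-syntax)
open import Relation.Nullary using (¬_; Dec; ¬?)
open import Relation.Unary using (Decidable)
open import Relation.Binary.PropositionalEquality using (_≡_)

-- Permutations of [n] (0-indexed as Fin n); w ⟨$⟩ʳ i is w(i) (one-line notation),
-- w ⟨$⟩ˡ j is w⁻¹(j).
S : ℕ → Set
S = Permutation′

e : ∀ {n} → S n
e = Perm.id

I : ∀ {n} → S n → Fin n → ℕ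
I {n} w i = length (filter (λ j → j <? i ×-dec (w ⟨$⟩ˡ i) <? (w ⟨$⟩ˡ j)) (allFin n))
  where
  open import Relation.Nullary.Decidable using (_×-dec_)

_≤ₘ_ : ∀ {n} → S n → S n → Set
v ≤ₘ w = ∀ i → I v i ℕ.≤ I w i

IsMeet : ∀ {n} → S n → S n → S n → Set
IsMeet m a b = m ≤ₘ a × m ≤ₘ b × (∀ c → c ≤ₘ a → c ≤ₘ b → c ≤ₘ m)

IsRelPseudoComplement : ∀ {n} → S n → S n → S n → Set
IsRelPseudoComplement r v w =
  (∃[ m ] (IsMeet m v r × m ≤ₘ w)) ×
  (∀ z m → IsMeet m v z → m ≤ₘ w → z ≤ₘ r)

IsPseudoComplement : ∀ {n} → S n → S n → Set
IsPseudoComplement p v = IsRelPseudoComplement p v e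

Regular : ∀ {n} → S n → Set
Regular v = ∃[ p ] ∃[ q ] (IsPseudoComplement p v × IsPseudoComplement q p × q ≈ v)

RLMin : ∀ {n} → S n → Fin n → Set
RLMin w k = ∀ j → (w ⟨$⟩ˡ k) Fin.< j → k Fin.< (w ⟨$⟩ʳ j)

RLMin? : ∀ {n} (w : S n) → Decidable (RLMin w)
RLMin? w k = all? (λ j → (w ⟨$⟩ˡ k) <? j →-dec k <? (w ⟨$⟩ʳ j))
  where
  open import Relation.Nullary.Decidable using (_→-dec_)

oneLine : ∀ {n} → S n → List (Fin n)
oneLine {n} w = map (w ⟨$⟩ʳ_) (allFin n)

rlMinWord : ∀ {n} → S n → List (Fin n)
rlMinWord {n} v = reverse (filter (RLMin? v) (allFin n)) ++ filter (λ k → ¬? (RLMin? v k)) (allFin n)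

Avoids132 : ∀ {n} → S n → Set
Avoids132 w = ∀ i j k → i Fin.< j → j Fin.< k →
  ¬ ((w ⟨$⟩ʳ i) Fin.< (w ⟨$⟩ʳ k) × (w ⟨$⟩ʳ k) Fin.< (w ⟨$⟩ʳ j))

Avoids231 : ∀ {n} → S n → Set
Avoids231 w = ∀ i j k → i Fin.< j → j Fin.< k →
  ¬ ((w ⟨$⟩ʳ k) Fin.< (w ⟨$⟩ʳ i) × (w ⟨$⟩ʳ i) Fin.< (w ⟨$⟩ʳ j))

-- The inversion sequence identifies the middle order with the product of the chains [0, i]
-- (i < n): every sequence c with c i ≤ i is realised by inserting the largest value n at position
-- n ∸ c n into a permutation realising the rest. Hence meets and relative pseudocomplements are
-- computed coordinatewise, and in the chain [0, t] the relative pseudocomplement of x with respect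
-- to y is t if x ≤ y and y otherwise. For ∼v this gives the coordinate i where I v i = 0, i.e. where
-- i is a right-to-left minimum, and 0 elsewhere; the coordinate i (resp. 0) puts the value i in
-- front of (resp. behind) all smaller values, which yields the one-line form. Finally v is regular
-- iff each coordinate is 0 or maximal, and a coordinate strictly in between means that some value
-- has a smaller value on each side, i.e. an occurrence of 132 or 231.

module Submission where

open import Defs
open import Data.Bool using (if_then_else_)
open import Data.Empty using (⊥; ⊥-elim)
open import Data.Fin as Fin using (Fin; zero; suc; toℕ; fromℕ; fromℕ<; punchIn)
open import Data.Fin.Permutation as Perm using (_⟨$⟩ʳ_; _⟨$⟩ˡ_; _≈_; insert; inverseˡ; inverseʳ)
open import Data.Fin.Properties as FinP using (_<?_; _≟_)
open import Data.List using (List; []; _∷_; _++_; _∷ʳ_; length; filter; map; reverse; tabulate; allFin)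
open import Data.List.Properties as ListP using ()
open import Data.Nat as ℕ using (ℕ; _+_; _∸_; _⊓_; _≤_; _<_; z≤n; s≤s)
open import Data.Nat.Properties as ℕP using (+-0-commutativeMonoid)
open import Data.Product using (_×_; _,_; proj₁; proj₂; ∃; ∃-syntax)
open import Data.Sum as Sum using (_⊎_; inj₁; inj₂)
open import Relation.Binary using (tri<; tri≈; tri>)
open import Function using (_∘_; _⇔_; mk⇔; Equivalence)
open import Level using (Level; 0ℓ)
open import Relation.Nullary using (¬_; Dec; yes; no; does; ¬?; contradiction)
open import Relation.Nullary.Decidable using (_×-dec_; decidable-stable)
open import Relation.Unary using (Pred; Decidable; _⊆_; _≐_)
open import Relation.Binary.PropositionalEquality

open import Algebra.Properties.CommutativeMonoid.Sum +-0-commutativeMonoid using (sum; sum-remove; sum-permute; sum-cong-≗)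

private
  variable
    ℓ ℓ′ a b : Level
    A : Set a
    B : Set b
    m n : ℕ

indicator : Dec A → ℕ
indicator A? = if does A? then 1 else 0

count : {P : Pred (Fin n) ℓ} → Decidable P → ℕ
count P? = sum (indicator ∘ P?)

count-cong : {P : Pred (Fin n) ℓ} {Q : Pred (Fin n) ℓ′} (P? : Decidable P) (Q? : Decidable Q) →
             P ≐ Q → count P? ≡ count Q?
count-cong P? Q? (P⊆Q , Q⊆P) = sum-cong-≗ indicator-cong
  where
  indicator-cong : ∀ i → indicator (P? i) ≡ indicator (Q? i)
  indicator-cong i with P? i | Q? i
  ... | yes _  | yes _  = refl
  ... | no _   | no _   = refl
  ... | yes Pi | no ¬Qi = contradiction (P⊆Q Pi) ¬Qi
  ... | no ¬Pi | yes Qi = contradiction (Q⊆P Qi) ¬Pi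

count-mono : {P : Pred (Fin n) ℓ} {Q : Pred (Fin n) ℓ′} (P? : Decidable P) (Q? : Decidable Q) →
             P ⊆ Q → count P? ≤ count Q?
count-mono {n = ℕ.zero} P? Q? P⊆Q = z≤n
count-mono {n = ℕ.suc n} P? Q? P⊆Q with P? zero | Q? zero
... | yes P0 | no ¬Q0 = contradiction (P⊆Q P0) ¬Q0
... | yes _  | yes _  = s≤s (count-mono (P? ∘ suc) (Q? ∘ suc) P⊆Q)
... | no _   | yes _  = ℕP.m≤n⇒m≤1+n (count-mono (P? ∘ suc) (Q? ∘ suc) P⊆Q)
... | no _   | no _   = count-mono (P? ∘ suc) (Q? ∘ suc) P⊆Q

count-remove : {P : Pred (Fin (ℕ.suc n)) ℓ} (P? : Decidable P) (a : Fin (ℕ.suc n)) →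
               count P? ≡ indicator (P? a) + count (P? ∘ punchIn a)
count-remove P? a = sum-remove {i = a} (indicator ∘ P?)

count-permute : {P : Pred (Fin n) ℓ} (P? : Decidable P) (π : Perm.Permutation m n) →
                count P? ≡ count (P? ∘ (π ⟨$⟩ʳ_))
count-permute P? π = sum-permute (indicator ∘ P?) π

count-remove-∉ : {P : Pred (Fin (ℕ.suc n)) ℓ} (P? : Decidable P) → ∀ {a} → ¬ P a →
                 count P? ≡ count (P? ∘ punchIn a)
count-remove-∉ P? {a} ¬Pa rewrite count-remove P? a with P? a
... | yes Pa = contradiction Pa ¬Pa
... | no _   = refl

count-mono-< : {P : Pred (Fin n) ℓ} {Q : Pred (Fin n) ℓ′} (P? : Decidable P) (Q? : Decidable Q) →
               P ⊆ Q → ∀ {a} → Q a → ¬ P a → count P? < count Q?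
count-mono-< {n = ℕ.suc n} P? Q? P⊆Q {a} Qa ¬Pa
  rewrite count-remove P? a | count-remove Q? a with P? a | Q? a
... | yes Pa | _     = contradiction Pa ¬Pa
... | _      | no ¬Qa = contradiction Qa ¬Qa
... | no _   | yes _  = s≤s (count-mono (P? ∘ punchIn a) (Q? ∘ punchIn a) P⊆Q)

count-none : {P : Pred (Fin n) ℓ} (P? : Decidable P) → (∀ a → ¬ P a) → count P? ≡ 0
count-none {n = ℕ.zero} P? ∄P = refl
count-none {n = ℕ.suc n} P? ∄P with P? zero
... | yes P0 = contradiction P0 (∄P zero)
... | no _   = count-none (P? ∘ suc) (∄P ∘ suc)

count-all : {P : Pred (Fin n) ℓ} (P? : Decidable P) → (∀ a → P a) → count P? ≡ n
count-all {n = ℕ.zero} P? ∀P = refl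
count-all {n = ℕ.suc n} P? ∀P with P? zero
... | yes _  = cong ℕ.suc (count-all (P? ∘ suc) (∀P ∘ suc))
... | no ¬P0 = contradiction (∀P zero) ¬P0

count-pos : {P : Pred (Fin n) ℓ} (P? : Decidable P) → ∀ {a} → P a → 0 < count P?
count-pos {n = ℕ.suc n} P? {a} Pa rewrite count-remove P? a with P? a
... | yes _  = s≤s z≤n
... | no ¬Pa = contradiction Pa ¬Pa

count≡0⇒∄ : {P : Pred (Fin n) ℓ} (P? : Decidable P) → count P? ≡ 0 → ∀ a → ¬ P a
count≡0⇒∄ P? #P≡0 a Pa = ℕP.<⇒≢ (count-pos P? Pa) (sym #P≡0)

below? : (i : Fin n) → Decidable (λ (j : Fin n) → j Fin.< i)
below? i j = j <? i

count-< : (i : Fin n) → count (below? i) ≡ toℕ i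
count-< i@zero  = count-none (below? i) (λ _ ())
count-< (suc i) = cong ℕ.suc (count-< i)

above? : (i : Fin n) → Decidable (λ (j : Fin n) → i Fin.< j)
above? i j = i <? j

count-> : (p : Fin n) → count (above? p) ≡ n ∸ ℕ.suc (toℕ p)
count-> p@zero  = count-all (above? p ∘ suc) (λ _ → s≤s z≤n)
count-> (suc p) = count-> p

count≢0⇒∃ : {P : Pred (Fin n) ℓ} (P? : Decidable P) → count P? ≢ 0 → ∃ P
count≢0⇒∃ P? #P≢0 with FinP.any? P?
... | yes ∃P = ∃P
... | no ∄P  = contradiction (count-none P? (λ a Pa → ∄P (a , Pa))) #P≢0

module _ {P : Pred (Fin n) ℓ} {Q : Pred (Fin n) ℓ′} (P? : Decidable P) (Q? : Decidable Q) (P⊆Q : P ⊆ Q) where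

  count≡⇒⊇ : count P? ≡ count Q? → Q ⊆ P
  count≡⇒⊇ #P≡#Q {a} Qa with P? a
  ... | yes Pa = Pa
  ... | no ¬Pa = contradiction #P≡#Q (ℕP.<⇒≢ (count-mono-< P? Q? P⊆Q Qa ¬Pa))

  count≢⇒∃ : count P? ≢ count Q? → ∃[ a ] (Q a × ¬ P a)
  count≢⇒∃ #P≢#Q with FinP.any? (λ a → Q? a ×-dec ¬? (P? a))
  ... | yes witness = witness
  ... | no none     = contradiction (count-cong P? Q? (P⊆Q , Q⊆P)) #P≢#Q
    where
    Q⊆P : Q ⊆ P
    Q⊆P {a} Qa = decidable-stable (P? a) (λ ¬Pa → none (a , Qa , ¬Pa))

_⇝[_]_ : ℕ → ℕ → ℕ → ℕ
x ⇝[ t ] y with x ℕ.≤? y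
... | yes _ = t
... | no _  = y

module _ {x y : ℕ} (t : ℕ) where

  ⇝-≤ : x ≤ y → x ⇝[ t ] y ≡ t
  ⇝-≤ x≤y with x ℕ.≤? y
  ... | yes _  = refl
  ... | no x≰y = contradiction x≤y x≰y

  ⇝-> : y < x → x ⇝[ t ] y ≡ y
  ⇝-> y<x with x ℕ.≤? y
  ... | yes x≤y = contradiction x≤y (ℕP.<⇒≱ y<x)
  ... | no _    = refl

  ⇝-bounded : y ≤ t → x ⇝[ t ] y ≤ t
  ⇝-bounded y≤t with x ℕ.≤? y
  ... | yes _ = ℕP.≤-refl
  ... | no _  = y≤t

  ⊓-⇝ : x ⊓ (x ⇝[ t ] y) ≤ y
  ⊓-⇝ with x ℕ.≤? y
  ... | yes x≤y = ℕP.≤-trans (ℕP.m⊓n≤m x t) x≤y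
  ... | no _    = ℕP.m⊓n≤n x y

  ⇝-greatest : ∀ {z} → z ≤ t → x ⊓ z ≤ y → z ≤ x ⇝[ t ] y
  ⇝-greatest {z} z≤t x⊓z≤y with x ℕ.≤? y | z ℕ.≤? y
  ... | yes _  | _      = z≤t
  ... | no _   | yes z≤y = z≤y
  ... | no x≰y | no z≰y = contradiction x⊓z≤y (ℕP.<⇒≱ (ℕP.⊓-glb (ℕP.≰⇒> x≰y) (ℕP.≰⇒> z≰y)))

module _ {x : ℕ} (t : ℕ) where

  ⇝0-extremal : x ⇝[ t ] 0 ≡ 0 ⊎ x ⇝[ t ] 0 ≡ t
  ⇝0-extremal with x ℕ.≤? 0
  ... | yes _ = inj₂ refl
  ... | no _  = inj₁ refl

  ⇝0-involutive : x ≡ 0 ⊎ x ≡ t → (x ⇝[ t ] 0) ⇝[ t ] 0 ≡ x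
  ⇝0-involutive (inj₁ refl) with t ℕ.≤? 0
  ... | yes t≤0 = ℕP.n≤0⇒n≡0 t≤0
  ... | no _    = refl
  ⇝0-involutive (inj₂ refl) with t ℕ.≤? 0
  ... | yes t≤0 rewrite ℕP.n≤0⇒n≡0 t≤0 = refl
  ... | no _    = refl

length-filter-tabulate : {P : Pred A ℓ} (P? : Decidable P) (f : Fin n → A) →
                         length (filter P? (tabulate f)) ≡ count (P? ∘ f)
length-filter-tabulate {n = ℕ.zero}  P? f = refl
length-filter-tabulate {n = ℕ.suc n} P? f with P? (f zero)
... | yes _ = cong ℕ.suc (length-filter-tabulate P? (f ∘ suc))
... | no _  = length-filter-tabulate P? (f ∘ suc)

Inversion : S n → Fin n → Pred (Fin n) 0ℓ
Inversion w i j = j Fin.< i × w ⟨$⟩ˡ i Fin.< w ⟨$⟩ˡ j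

inversion? : (w : S n) (i : Fin n) → Decidable (Inversion w i)
inversion? w i j = j <? i ×-dec w ⟨$⟩ˡ i <? w ⟨$⟩ˡ j

I≡count : (w : S n) (i : Fin n) → I w i ≡ count (inversion? w i)
I≡count w i = length-filter-tabulate (inversion? w i) (λ j → j)

InversionSeq : (Fin n → ℕ) → Set
InversionSeq c = ∀ i → c i ≤ toℕ i

I-inversionSeq : (w : S n) → InversionSeq (I w)
I-inversionSeq w i = begin
  I w i                    ≡⟨ I≡count w i ⟩
  count (inversion? w i)   ≤⟨ count-mono (inversion? w i) (below? i) proj₁ ⟩
  count (below? i)         ≡⟨ count-< i ⟩
  toℕ i                    ∎
  where open ℕP.≤-Reasoning

I-id : (i : Fin n) → I e i ≡ 0
I-id i = trans (I≡count e i) (count-none (inversion? e i) (λ j (j<i , i<j) → FinP.<-asym j<i i<j))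

I-cong : (v w : S n) → v ≈ w → ∀ i → I v i ≡ I w i
I-cong v w v≈w i = begin
  I v i                   ≡⟨ I≡count v i ⟩
  count (inversion? v i)  ≡⟨ count-cong (inversion? v i) (inversion? w i) (Inversion-cong , Inversion-cong′) ⟩
  count (inversion? w i)  ≡⟨ I≡count w i ⟨
  I w i                   ∎
  where
  open ≡-Reasoning
  v⁻¹≡w⁻¹ : ∀ j → v ⟨$⟩ˡ j ≡ w ⟨$⟩ˡ j
  v⁻¹≡w⁻¹ j = begin
    v ⟨$⟩ˡ j                        ≡⟨ cong (v ⟨$⟩ˡ_) (inverseʳ w) ⟨
    v ⟨$⟩ˡ (w ⟨$⟩ʳ (w ⟨$⟩ˡ j))      ≡⟨ cong (v ⟨$⟩ˡ_) (v≈w (w ⟨$⟩ˡ j)) ⟨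
    v ⟨$⟩ˡ (v ⟨$⟩ʳ (w ⟨$⟩ˡ j))      ≡⟨ inverseˡ v ⟩
    w ⟨$⟩ˡ j                        ∎
  Inversion-cong : Inversion v i ⊆ Inversion w i
  Inversion-cong (j<i , lt) = j<i , subst₂ Fin._<_ (v⁻¹≡w⁻¹ i) (v⁻¹≡w⁻¹ _) lt
  Inversion-cong′ : Inversion w i ⊆ Inversion v i
  Inversion-cong′ (j<i , lt) = j<i , subst₂ Fin._<_ (sym (v⁻¹≡w⁻¹ i)) (sym (v⁻¹≡w⁻¹ _)) lt

module _ (w : S n) {i : Fin n} where

  I≡0⇒¬Inversion : I w i ≡ 0 → ∀ j → ¬ Inversion w i j
  I≡0⇒¬Inversion I≡0 = count≡0⇒∄ (inversion? w i) (trans (sym (I≡count w i)) I≡0)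

  ¬Inversion⇒I≡0 : (∀ j → ¬ Inversion w i j) → I w i ≡ 0
  ¬Inversion⇒I≡0 ∄ = trans (I≡count w i) (count-none (inversion? w i) ∄)

  I≢0⇒Inversion : I w i ≢ 0 → ∃ (Inversion w i)
  I≢0⇒Inversion I≢0 = count≢0⇒∃ (inversion? w i) (I≢0 ∘ trans (I≡count w i))

  I≡toℕ⇒Inversion : I w i ≡ toℕ i → ∀ {j} → j Fin.< i → Inversion w i j
  I≡toℕ⇒Inversion I≡i = count≡⇒⊇ (inversion? w i) (below? i) proj₁
    (trans (sym (I≡count w i)) (trans I≡i (sym (count-< i))))

  I≢toℕ⇒¬Inversion : I w i ≢ toℕ i → ∃[ j ] (j Fin.< i × ¬ Inversion w i j)
  I≢toℕ⇒¬Inversion I≢i = count≢⇒∃ (inversion? w i) (below? i) proj₁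
    (λ #≡ → I≢i (trans (I≡count w i) (trans #≡ (count-< i))))

punchIn-mono-< : (p : Fin (ℕ.suc n)) {j k : Fin n} → j Fin.< k → punchIn p j Fin.< punchIn p k
punchIn-mono-< p {j} {k} j<k = FinP.≤∧≢⇒<
  (FinP.punchIn-mono-≤ p j k (ℕP.<⇒≤ j<k))
  (FinP.<⇒≢ j<k ∘ FinP.punchIn-injective p j k)

punchIn-cancel-< : (p : Fin (ℕ.suc n)) {j k : Fin n} → punchIn p j Fin.< punchIn p k → j Fin.< k
punchIn-cancel-< p {j} {k} pj<pk = FinP.≤∧≢⇒<
  (FinP.punchIn-cancel-≤ p j k (ℕP.<⇒≤ pj<pk))
  (FinP.<⇒≢ pj<pk ∘ cong (punchIn p))

self-or-punchIn : (p i : Fin (ℕ.suc n)) → i ≡ p ⊎ ∃[ k ] punchIn p k ≡ i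
self-or-punchIn p i with p ≟ i
... | yes refl = inj₁ refl
... | no p≢i   = inj₂ (Fin.punchOut p≢i , FinP.punchIn-punchOut p≢i)

toℕ-punchIn-fromℕ : (k : Fin n) → toℕ (punchIn (fromℕ n) k) ≡ toℕ k
toℕ-punchIn-fromℕ zero    = refl
toℕ-punchIn-fromℕ (suc k) = cong ℕ.suc (toℕ-punchIn-fromℕ k)


fromℕ-≮ : (j : Fin (ℕ.suc n)) → ¬ fromℕ n Fin.< j
fromℕ-≮ j = ℕP.≤⇒≯ (FinP.≤fromℕ j)

⟨$⟩ʳ-injective : (π : Perm.Permutation m n) {i j : Fin m} → π ⟨$⟩ʳ i ≡ π ⟨$⟩ʳ j → i ≡ j
⟨$⟩ʳ-injective π πi≡πj = trans (sym (inverseˡ π)) (trans (cong (π ⟨$⟩ˡ_) πi≡πj) (inverseˡ π))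

module _ {m n} (i : Fin (ℕ.suc m)) (j : Fin (ℕ.suc n)) (π : Perm.Permutation m n) where

  insert-self : insert i j π ⟨$⟩ʳ i ≡ j
  insert-self with i ≟ i
  ... | yes _  = refl
  ... | no i≢i = contradiction refl i≢i

  insert-inverse-self : insert i j π ⟨$⟩ˡ j ≡ i
  insert-inverse-self = trans (cong (insert i j π ⟨$⟩ˡ_) (sym insert-self)) (inverseˡ (insert i j π))

  insert-inverse-punchIn : ∀ k → insert i j π ⟨$⟩ˡ punchIn j k ≡ punchIn i (π ⟨$⟩ˡ k)
  insert-inverse-punchIn k = begin
    σ ⟨$⟩ˡ punchIn j k                    ≡⟨ cong (λ l → σ ⟨$⟩ˡ punchIn j l) (inverseʳ π) ⟨
    σ ⟨$⟩ˡ punchIn j (π ⟨$⟩ʳ (π ⟨$⟩ˡ k))  ≡⟨ cong (σ ⟨$⟩ˡ_) (Perm.insert-punchIn i j π (π ⟨$⟩ˡ k)) ⟨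
    σ ⟨$⟩ˡ (σ ⟨$⟩ʳ punchIn i (π ⟨$⟩ˡ k))  ≡⟨ inverseˡ σ ⟩
    punchIn i (π ⟨$⟩ˡ k)                  ∎
    where
    open ≡-Reasoning
    σ = insert i j π

module _ (p : Fin (ℕ.suc n)) (π : S n) where

  private
    L = fromℕ n
    σ = insert p L π

  I-insert-fromℕ : I σ L ≡ n ∸ toℕ p
  I-insert-fromℕ = begin
    I σ L                                  ≡⟨ I≡count σ L ⟩
    count (inversion? σ L)
      ≡⟨ count-cong (inversion? σ L) (above? p ∘ (σ ⟨$⟩ˡ_)) (⇒after , after⇒) ⟩
    count (above? p ∘ (σ ⟨$⟩ˡ_))           ≡⟨ count-permute (above? p) (Perm.flip σ) ⟨
    count (above? p)                       ≡⟨ count-> p ⟩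
    n ∸ toℕ p                              ∎
    where
    open ≡-Reasoning
    ⇒after : ∀ {j} → Inversion σ L j → p Fin.< σ ⟨$⟩ˡ j
    ⇒after {j} (_ , L<j) = subst (Fin._< σ ⟨$⟩ˡ j) (insert-inverse-self p L π) L<j
    after⇒ : ∀ {j} → p Fin.< σ ⟨$⟩ˡ j → Inversion σ L j
    after⇒ {j} p<j = FinP.≤∧≢⇒< (FinP.≤fromℕ j) j≢L ,
                     subst (Fin._< σ ⟨$⟩ˡ j) (sym (insert-inverse-self p L π)) p<j
      where
      j≢L : j ≢ L
      j≢L refl = FinP.<-irrefl refl (subst (p Fin.<_) (insert-inverse-self p L π) p<j)

  I-insert-punchIn : ∀ i → I σ (punchIn L i) ≡ I π i
  I-insert-punchIn i = begin
    I σ (punchIn L i)          ≡⟨ I≡count σ (punchIn L i) ⟩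
    count inv-σ                ≡⟨ count-remove-∉ inv-σ (fromℕ-≮ _ ∘ proj₁) ⟩
    count (inv-σ ∘ punchIn L)  ≡⟨ count-cong (inv-σ ∘ punchIn L) (inversion? π i) (restrict , extend) ⟩
    count (inversion? π i)     ≡⟨ I≡count π i ⟨
    I π i                      ∎
    where
    open ≡-Reasoning
    inv-σ = inversion? σ (punchIn L i)
    restrict : ∀ {k} → Inversion σ (punchIn L i) (punchIn L k) → Inversion π i k
    restrict (k<i , lt) = punchIn-cancel-< L k<i ,
      punchIn-cancel-< p (subst₂ Fin._<_ (insert-inverse-punchIn p L π i) (insert-inverse-punchIn p L π _) lt)
    extend : ∀ {k} → Inversion π i k → Inversion σ (punchIn L i) (punchIn L k)
    extend (k<i , lt) = punchIn-mono-< L k<i ,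
      subst₂ Fin._<_ (sym (insert-inverse-punchIn p L π i)) (sym (insert-inverse-punchIn p L π _)) (punchIn-mono-< p lt)

fromEnd : ∀ n → ℕ → Fin (ℕ.suc n)
fromEnd n x = fromℕ< (s≤s (ℕP.m∸n≤m n x))

toℕ-fromEnd : ∀ n x → toℕ (fromEnd n x) ≡ n ∸ x
toℕ-fromEnd n x = FinP.toℕ-fromℕ< (s≤s (ℕP.m∸n≤m n x))

-- The largest value n is placed at position n ∸ c n, so exactly c n smaller values follow it.
fromInversionSeq : (Fin n → ℕ) → S n
fromInversionSeq {ℕ.zero}  c = e
fromInversionSeq {ℕ.suc n} c =
  insert (fromEnd n (c (fromℕ n))) (fromℕ n) (fromInversionSeq (c ∘ punchIn (fromℕ n)))

I-fromInversionSeq : {c : Fin n → ℕ} → InversionSeq c → ∀ i → I (fromInversionSeq c) i ≡ c i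
I-fromInversionSeq {ℕ.suc n} {c} c-seq i = by-cases (self-or-punchIn L i)
  where
  open ≡-Reasoning
  L = fromℕ n
  p = fromEnd n (c L)
  π = fromInversionSeq (c ∘ punchIn L)
  c∘punchIn-seq : InversionSeq (c ∘ punchIn L)
  c∘punchIn-seq j = subst (c (punchIn L j) ≤_) (toℕ-punchIn-fromℕ j) (c-seq (punchIn L j))
  by-cases : ∀ {i} → i ≡ L ⊎ ∃[ k ] punchIn L k ≡ i → I (insert p L π) i ≡ c i
  by-cases (inj₁ refl) = begin
    I (insert p L π) L     ≡⟨ I-insert-fromℕ p π ⟩
    n ∸ toℕ p              ≡⟨ cong (n ∸_) (toℕ-fromEnd n (c L)) ⟩
    n ∸ (n ∸ c L)          ≡⟨ ℕP.m∸[m∸n]≡n (subst (c L ≤_) (FinP.toℕ-fromℕ n) (c-seq L)) ⟩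
    c L                    ∎
  by-cases (inj₂ (k , refl)) = begin
    I (insert p L π) (punchIn L k)  ≡⟨ I-insert-punchIn p π k ⟩
    I π k                           ≡⟨ I-fromInversionSeq c∘punchIn-seq k ⟩
    c (punchIn L k)                 ∎

meet : S n → S n → S n
meet a b = fromInversionSeq (λ i → I a i ⊓ I b i)

I-meet : (a b : S n) → ∀ i → I (meet a b) i ≡ I a i ⊓ I b i
I-meet a b = I-fromInversionSeq (λ i → ℕP.≤-trans (ℕP.m⊓n≤m (I a i) (I b i)) (I-inversionSeq a i))

meet-isMeet : (a b : S n) → IsMeet (meet a b) a b
meet-isMeet a b =
  (λ i → subst (_≤ I a i) (sym (I-meet a b i)) (ℕP.m⊓n≤m (I a i) (I b i))) ,
  (λ i → subst (_≤ I b i) (sym (I-meet a b i)) (ℕP.m⊓n≤n (I a i) (I b i))) ,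
  (λ c c≤a c≤b i → subst (I c i ≤_) (sym (I-meet a b i)) (ℕP.⊓-glb (c≤a i) (c≤b i)))

IsMeet⇒I≡⊓ : (m a b : S n) → IsMeet m a b → ∀ i → I m i ≡ I a i ⊓ I b i
IsMeet⇒I≡⊓ m a b (m≤a , m≤b , greatest) i = ℕP.≤-antisym
  (ℕP.⊓-glb (m≤a i) (m≤b i))
  (subst (_≤ _) (I-meet a b i) (greatest (meet a b) meet≤a meet≤b i))
  where
  meet≤a = proj₁ (meet-isMeet a b)
  meet≤b = proj₁ (proj₂ (meet-isMeet a b))

RelPseudoComplementSeq : S n → S n → Fin n → ℕ
RelPseudoComplementSeq v w i = I v i ⇝[ toℕ i ] I w i

I⇒IsRelPseudoComplement : (r v w : S n) → (∀ i → I r i ≡ RelPseudoComplementSeq v w i) →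
                          IsRelPseudoComplement r v w
I⇒IsRelPseudoComplement r v w I-r = (meet v r , meet-isMeet v r , meet≤w) , greatest
  where
  meet≤w : meet v r ≤ₘ w
  meet≤w i = subst (_≤ I w i) (sym (trans (I-meet v r i) (cong (I v i ⊓_) (I-r i)))) (⊓-⇝ (toℕ i))
  greatest : ∀ z m → IsMeet m v z → m ≤ₘ w → z ≤ₘ r
  greatest z m m-meet m≤w i = subst (I z i ≤_) (sym (I-r i)) (⇝-greatest (toℕ i) (I-inversionSeq z i) v⊓z≤w)
    where
    v⊓z≤w : I v i ⊓ I z i ≤ I w i
    v⊓z≤w = subst (_≤ I w i) (IsMeet⇒I≡⊓ m v z m-meet i) (m≤w i)

_⇝_ : S n → S n → S n
v ⇝ w = fromInversionSeq (RelPseudoComplementSeq v w)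

I-⇝ : (v w : S n) → ∀ i → I (v ⇝ w) i ≡ RelPseudoComplementSeq v w i
I-⇝ v w = I-fromInversionSeq (λ i → ⇝-bounded (toℕ i) (I-inversionSeq w i))

⇝-isRelPseudoComplement : (v w : S n) → IsRelPseudoComplement (v ⇝ w) v w
⇝-isRelPseudoComplement v w = I⇒IsRelPseudoComplement (v ⇝ w) v w (I-⇝ v w)

IsRelPseudoComplement⇒I : (r v w : S n) → IsRelPseudoComplement r v w →
                          ∀ i → I r i ≡ RelPseudoComplementSeq v w i
IsRelPseudoComplement⇒I r v w ((m , m-meet , m≤w) , greatest) i = ℕP.≤-antisym
  (⇝-greatest (toℕ i) (I-inversionSeq r i) v⊓r≤w)
  (subst (_≤ I r i) (I-⇝ v w i) (greatest (v ⇝ w) m₀ m₀-meet m₀≤w i))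
  where
  v⊓r≤w : I v i ⊓ I r i ≤ I w i
  v⊓r≤w = subst (_≤ I w i) (IsMeet⇒I≡⊓ m v r m-meet i) (m≤w i)
  m₀ = meet v (v ⇝ w)
  m₀-meet = meet-isMeet v (v ⇝ w)
  m₀≤w = proj₂ (proj₂ (proj₁ (⇝-isRelPseudoComplement v w)))

module _ (w : S n) {k : Fin n} where

  RLMin⇒I≡0 : RLMin w k → I w k ≡ 0
  RLMin⇒I≡0 rlmin = ¬Inversion⇒I≡0 w λ j (j<k , k-before-j) →
    FinP.<-asym j<k (subst (k Fin.<_) (inverseʳ w) (rlmin (w ⟨$⟩ˡ j) k-before-j))

  I≡0⇒RLMin : I w k ≡ 0 → RLMin w k
  I≡0⇒RLMin I≡0 j k-before-j = FinP.≤∧≢⇒< (ℕP.≮⇒≥ wj≮k) k≢wj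
    where
    wj≮k : ¬ w ⟨$⟩ʳ j Fin.< k
    wj≮k wj<k = I≡0⇒¬Inversion w I≡0 (w ⟨$⟩ʳ j) (wj<k , subst (w ⟨$⟩ˡ k Fin.<_) (sym (inverseˡ w)) k-before-j)
    k≢wj : k ≢ w ⟨$⟩ʳ j
    k≢wj refl = FinP.<-irrefl (inverseˡ w) k-before-j

Extremal : S n → Set
Extremal w = ∀ i → I w i ≡ 0 ⊎ I w i ≡ toℕ i

PeakFree : S n → Set
PeakFree w = ∀ {i j k} → i Fin.< j → j Fin.< k →
             w ⟨$⟩ʳ i Fin.< w ⟨$⟩ʳ j → w ⟨$⟩ʳ k Fin.< w ⟨$⟩ʳ j → ⊥

module _ (w : S n) where

  peakFree⇒avoids : PeakFree w → Avoids132 w × Avoids231 w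
  peakFree⇒avoids peakFree =
    (λ i j k i<j j<k (wi<wk , wk<wj) → peakFree i<j j<k (FinP.<-trans wi<wk wk<wj) wk<wj) ,
    (λ i j k i<j j<k (wk<wi , wi<wj) → peakFree i<j j<k wi<wj (FinP.<-trans wk<wi wi<wj))

  avoids⇒peakFree : Avoids132 w × Avoids231 w → PeakFree w
  avoids⇒peakFree (avoids132 , avoids231) {i} {j} {k} i<j j<k wi<wj wk<wj with FinP.<-cmp (w ⟨$⟩ʳ i) (w ⟨$⟩ʳ k)
  ... | tri< wi<wk _ _ = avoids132 i j k i<j j<k (wi<wk , wk<wj)
  ... | tri> _ _ wk<wi = avoids231 i j k i<j j<k (wk<wi , wi<wj)
  ... | tri≈ _ wi≡wk _ = FinP.<-irrefl (⟨$⟩ʳ-injective w wi≡wk) (FinP.<-trans i<j j<k)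

  Extremal⇒peakFree : Extremal w → PeakFree w
  Extremal⇒peakFree extremal {i} {j} {k} i<j j<k wi<wj wk<wj with extremal (w ⟨$⟩ʳ j)
  ... | inj₁ I≡0 = I≡0⇒¬Inversion w I≡0 (w ⟨$⟩ʳ k)
                     (wk<wj , subst₂ Fin._<_ (sym (inverseˡ w)) (sym (inverseˡ w)) j<k)
  ... | inj₂ I≡b = FinP.<-asym i<j
                     (subst₂ Fin._<_ (inverseˡ w) (inverseˡ w) (proj₂ (I≡toℕ⇒Inversion w I≡b wi<wj)))

  peakFree⇒Extremal : PeakFree w → Extremal w
  peakFree⇒Extremal peakFree b with I w b ℕ.≟ 0 | I w b ℕ.≟ toℕ b
  ... | yes I≡0 | _       = inj₁ I≡0
  ... | no _    | yes I≡b = inj₂ I≡b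
  ... | no I≢0  | no I≢b  with I≢0⇒Inversion w I≢0 | I≢toℕ⇒¬Inversion w I≢b
  ...   | c , c<b , b-before-c | a , a<b , ¬a-after-b =
    ⊥-elim (peakFree a-before-b b-before-c (at-positions a<b) (at-positions c<b))
    where
    at-positions : ∀ {x y} → x Fin.< y → w ⟨$⟩ʳ (w ⟨$⟩ˡ x) Fin.< w ⟨$⟩ʳ (w ⟨$⟩ˡ y)
    at-positions = subst₂ Fin._<_ (sym (inverseʳ w)) (sym (inverseʳ w))
    a-before-b : w ⟨$⟩ˡ a Fin.< w ⟨$⟩ˡ b
    a-before-b = FinP.≤∧≢⇒< (ℕP.≮⇒≥ (λ b<a → ¬a-after-b (a<b , b<a)))
                              (FinP.<⇒≢ a<b ∘ ⟨$⟩ʳ-injective (Perm.flip w))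

filter-map : {P : Pred B ℓ} (P? : Decidable P) (f : A → B) (xs : List A) →
             filter P? (map f xs) ≡ map f (filter (P? ∘ f) xs)
filter-map P? f []       = refl
filter-map P? f (x ∷ xs) with P? (f x)
... | yes _ = cong (f x ∷_) (filter-map P? f xs)
... | no _  = filter-map P? f xs

selectionWord : {Q : Pred A ℓ} → Decidable Q → List A → List A
selectionWord Q? xs = reverse (filter Q? xs) ++ filter (¬? ∘ Q?) xs

selectionWord-map : {Q : Pred B ℓ} (Q? : Decidable Q) (f : A → B) (xs : List A) →
                    selectionWord Q? (map f xs) ≡ map f (selectionWord (Q? ∘ f) xs)
selectionWord-map Q? f xs = begin
  reverse (filter Q? (map f xs)) ++ filter (¬? ∘ Q?) (map f xs)
    ≡⟨ cong₂ (λ ys zs → reverse ys ++ zs) (filter-map Q? f xs) (filter-map (¬? ∘ Q?) f xs) ⟩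
  reverse (map f (filter (Q? ∘ f) xs)) ++ map f (filter (¬? ∘ Q? ∘ f) xs)
    ≡⟨ cong (_++ map f (filter (¬? ∘ Q? ∘ f) xs)) (ListP.reverse-map f (filter (Q? ∘ f) xs)) ⟨
  map f (reverse (filter (Q? ∘ f) xs)) ++ map f (filter (¬? ∘ Q? ∘ f) xs)
    ≡⟨ ListP.map-++ f (reverse (filter (Q? ∘ f) xs)) _ ⟨
  map f (selectionWord (Q? ∘ f) xs)
    ∎
  where open ≡-Reasoning

module _ {P : Pred A ℓ} (P? : Decidable P) (xs : List A) {x : A} where

  filter-∷ʳ-accept : P x → filter P? (xs ∷ʳ x) ≡ filter P? xs ∷ʳ x
  filter-∷ʳ-accept Px = trans (ListP.filter-++ P? xs _) (cong (filter P? xs ++_) (ListP.filter-accept P? Px))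

  filter-∷ʳ-reject : ¬ P x → filter P? (xs ∷ʳ x) ≡ filter P? xs
  filter-∷ʳ-reject ¬Px = begin
    filter P? (xs ∷ʳ x)                 ≡⟨ ListP.filter-++ P? xs _ ⟩
    filter P? xs ++ filter P? (x ∷ [])  ≡⟨ cong (filter P? xs ++_) (ListP.filter-reject P? ¬Px) ⟩
    filter P? xs ++ []                  ≡⟨ ListP.++-identityʳ _ ⟩
    filter P? xs                        ∎
    where open ≡-Reasoning

module _ {P : Pred A ℓ} (P? : Decidable P) (xs : List A) {x : A} where

  selectionWord-∷ʳ-accept : P x → selectionWord P? (xs ∷ʳ x) ≡ x ∷ selectionWord P? xs
  selectionWord-∷ʳ-accept Px = begin
    reverse (filter P? (xs ∷ʳ x)) ++ filter (¬? ∘ P?) (xs ∷ʳ x)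
      ≡⟨ cong₂ (λ ys zs → reverse ys ++ zs) (filter-∷ʳ-accept P? xs Px) (filter-∷ʳ-reject (¬? ∘ P?) xs (λ ¬Px → ¬Px Px)) ⟩
    reverse (filter P? xs ∷ʳ x) ++ filter (¬? ∘ P?) xs
      ≡⟨ cong (_++ filter (¬? ∘ P?) xs) (ListP.reverse-++ (filter P? xs) (x ∷ [])) ⟩
    x ∷ selectionWord P? xs
      ∎
    where open ≡-Reasoning

  selectionWord-∷ʳ-reject : ¬ P x → selectionWord P? (xs ∷ʳ x) ≡ selectionWord P? xs ∷ʳ x
  selectionWord-∷ʳ-reject ¬Px = begin
    reverse (filter P? (xs ∷ʳ x)) ++ filter (¬? ∘ P?) (xs ∷ʳ x)
      ≡⟨ cong₂ (λ ys zs → reverse ys ++ zs) (filter-∷ʳ-reject P? xs ¬Px) (filter-∷ʳ-accept (¬? ∘ P?) xs ¬Px) ⟩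
    reverse (filter P? xs) ++ (filter (¬? ∘ P?) xs ∷ʳ x)
      ≡⟨ ListP.++-assoc (reverse (filter P? xs)) _ _ ⟨
    selectionWord P? xs ∷ʳ x
      ∎
    where open ≡-Reasoning

tabulate-∷ʳ-fromℕ : (f : Fin (ℕ.suc n) → A) → tabulate f ≡ tabulate (f ∘ punchIn (fromℕ n)) ∷ʳ f (fromℕ n)
tabulate-∷ʳ-fromℕ {n = ℕ.zero}  f = refl
tabulate-∷ʳ-fromℕ {n = ℕ.suc n} f = cong (f zero ∷_) (tabulate-∷ʳ-fromℕ (f ∘ suc))

map-oneLine : (f : Fin n → A) (π : S n) → map f (oneLine π) ≡ tabulate (f ∘ (π ⟨$⟩ʳ_))
map-oneLine f π = trans (cong (map f) (ListP.map-tabulate (λ i → i) (π ⟨$⟩ʳ_))) (ListP.map-tabulate (π ⟨$⟩ʳ_) f)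

module _ (j : Fin (ℕ.suc n)) (π : S n) where

  oneLine-insert-zero : oneLine (insert zero j π) ≡ j ∷ map (punchIn j) (oneLine π)
  oneLine-insert-zero = cong₂ _∷_ (insert-self zero j π) (begin
    map (insert zero j π ⟨$⟩ʳ_) (tabulate suc)    ≡⟨ ListP.map-tabulate suc _ ⟩
    tabulate ((insert zero j π ⟨$⟩ʳ_) ∘ suc)      ≡⟨ ListP.tabulate-cong (Perm.insert-punchIn zero j π) ⟩
    tabulate (punchIn j ∘ (π ⟨$⟩ʳ_))             ≡⟨ map-oneLine (punchIn j) π ⟨
    map (punchIn j) (oneLine π)                   ∎)
    where open ≡-Reasoning

  oneLine-insert-fromℕ : oneLine (insert (fromℕ n) j π) ≡ map (punchIn j) (oneLine π) ∷ʳ j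
  oneLine-insert-fromℕ = begin
    map (σ ⟨$⟩ʳ_) (allFin (ℕ.suc n))
      ≡⟨ cong (map (σ ⟨$⟩ʳ_)) (tabulate-∷ʳ-fromℕ (λ i → i)) ⟩
    map (σ ⟨$⟩ʳ_) (tabulate (punchIn L) ∷ʳ L)          ≡⟨ ListP.map-++ (σ ⟨$⟩ʳ_) (tabulate (punchIn L)) _ ⟩
    map (σ ⟨$⟩ʳ_) (tabulate (punchIn L)) ∷ʳ (σ ⟨$⟩ʳ L) ≡⟨ cong₂ _∷ʳ_ σ∘punchIn (insert-self L j π) ⟩
    map (punchIn j) (oneLine π) ∷ʳ j                   ∎
    where
    open ≡-Reasoning
    L = fromℕ n
    σ = insert L j π
    σ∘punchIn : map (σ ⟨$⟩ʳ_) (tabulate (punchIn L)) ≡ map (punchIn j) (oneLine π)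
    σ∘punchIn = begin
      map (σ ⟨$⟩ʳ_) (tabulate (punchIn L))   ≡⟨ ListP.map-tabulate (punchIn L) _ ⟩
      tabulate ((σ ⟨$⟩ʳ_) ∘ punchIn L)       ≡⟨ ListP.tabulate-cong (Perm.insert-punchIn L j π) ⟩
      tabulate (punchIn j ∘ (π ⟨$⟩ʳ_))      ≡⟨ map-oneLine (punchIn j) π ⟨
      map (punchIn j) (oneLine π)            ∎

allFin-∷ʳ-fromℕ : ∀ n → allFin (ℕ.suc n) ≡ map (punchIn (fromℕ n)) (allFin n) ∷ʳ fromℕ n
allFin-∷ʳ-fromℕ n = trans (tabulate-∷ʳ-fromℕ (λ i → i))
  (cong (_∷ʳ fromℕ n) (sym (ListP.map-tabulate (λ i → i) (punchIn (fromℕ n)))))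

-- c n = n puts n in front of all smaller values, c n = 0 behind them.
oneLine-fromInversionSeq : {Q : Pred (Fin n) ℓ} (Q? : Decidable Q) {c : Fin n → ℕ} →
                           (∀ i → Q i → c i ≡ toℕ i) → (∀ i → ¬ Q i → c i ≡ 0) →
                           oneLine (fromInversionSeq c) ≡ selectionWord Q? (allFin n)
oneLine-fromInversionSeq {n = ℕ.zero}  Q? c-Q c-¬Q = refl
oneLine-fromInversionSeq {n = ℕ.suc n} {Q = Q} Q? {c} c-Q c-¬Q = by-cases (Q? L)
  where
  open ≡-Reasoning
  L = fromℕ n
  π = fromInversionSeq (c ∘ punchIn L)
  ys = map (punchIn L) (allFin n)
  c∘punchIn-Q : ∀ i → Q (punchIn L i) → c (punchIn L i) ≡ toℕ i
  c∘punchIn-Q i Q-i = trans (c-Q _ Q-i) (toℕ-punchIn-fromℕ i)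
  IH : map (punchIn L) (oneLine π) ≡ selectionWord Q? ys
  IH = begin
    map (punchIn L) (oneLine π)
      ≡⟨ cong (map (punchIn L)) (oneLine-fromInversionSeq (Q? ∘ punchIn L) c∘punchIn-Q (c-¬Q ∘ punchIn L)) ⟩
    map (punchIn L) (selectionWord (Q? ∘ punchIn L) (allFin n))
      ≡⟨ selectionWord-map Q? (punchIn L) (allFin n) ⟨
    selectionWord Q? ys
      ∎
  by-cases : Dec (Q L) → oneLine (fromInversionSeq c) ≡ selectionWord Q? (allFin (ℕ.suc n))
  by-cases (yes Q-L) = begin
    oneLine (insert (fromEnd n (c L)) L π)  ≡⟨ cong (λ p → oneLine (insert p L π)) at-front ⟩
    oneLine (insert zero L π)               ≡⟨ oneLine-insert-zero L π ⟩
    L ∷ map (punchIn L) (oneLine π)         ≡⟨ cong (L ∷_) IH ⟩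
    L ∷ selectionWord Q? ys                 ≡⟨ selectionWord-∷ʳ-accept Q? ys Q-L ⟨
    selectionWord Q? (ys ∷ʳ L)              ≡⟨ cong (selectionWord Q?) (allFin-∷ʳ-fromℕ n) ⟨
    selectionWord Q? (allFin (ℕ.suc n))     ∎
    where
    at-front : fromEnd n (c L) ≡ zero
    at-front = FinP.toℕ-injective (begin
      toℕ (fromEnd n (c L))   ≡⟨ toℕ-fromEnd n (c L) ⟩
      n ∸ c L                 ≡⟨ cong (n ∸_) (trans (c-Q L Q-L) (FinP.toℕ-fromℕ n)) ⟩
      n ∸ n                   ≡⟨ ℕP.n∸n≡0 n ⟩
      0                       ∎)
  by-cases (no ¬Q-L) = begin
    oneLine (insert (fromEnd n (c L)) L π)  ≡⟨ cong (λ p → oneLine (insert p L π)) at-back ⟩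
    oneLine (insert L L π)                  ≡⟨ oneLine-insert-fromℕ L π ⟩
    map (punchIn L) (oneLine π) ∷ʳ L        ≡⟨ cong (_∷ʳ L) IH ⟩
    selectionWord Q? ys ∷ʳ L                ≡⟨ selectionWord-∷ʳ-reject Q? ys ¬Q-L ⟨
    selectionWord Q? (ys ∷ʳ L)              ≡⟨ cong (selectionWord Q?) (allFin-∷ʳ-fromℕ n) ⟨
    selectionWord Q? (allFin (ℕ.suc n))     ∎
    where
    at-back : fromEnd n (c L) ≡ L
    at-back = FinP.toℕ-injective (begin
      toℕ (fromEnd n (c L))   ≡⟨ toℕ-fromEnd n (c L) ⟩
      n ∸ c L                 ≡⟨ cong (n ∸_) (c-¬Q L ¬Q-L) ⟩
      n                       ≡⟨ FinP.toℕ-fromℕ n ⟨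
      toℕ L                   ∎)

Extremal⇔avoids : (w : S n) → Extremal w ⇔ (Avoids132 w × Avoids231 w)
Extremal⇔avoids w = mk⇔ (peakFree⇒avoids w ∘ Extremal⇒peakFree w) (peakFree⇒Extremal w ∘ avoids⇒peakFree w)

IsPseudoComplement⇒I : (p v : S n) → IsPseudoComplement p v → ∀ i → I p i ≡ I v i ⇝[ toℕ i ] 0
IsPseudoComplement⇒I p v p-pc i =
  trans (IsRelPseudoComplement⇒I p v e p-pc i) (cong (I v i ⇝[ toℕ i ]_) (I-id i))

IsPseudoComplement⇒Extremal : (p v : S n) → IsPseudoComplement p v → Extremal p
IsPseudoComplement⇒Extremal p v p-pc i = Sum.map (trans I-p) (trans I-p) (⇝0-extremal (toℕ i))
  where
  I-p = IsPseudoComplement⇒I p v p-pc i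

relPseudoComplement-inversionSeq : (v w : S n) → ∃[ r ] (IsRelPseudoComplement r v w ×
  (∀ i → (I v i ≤ I w i → I r i ≡ toℕ i) × (I w i < I v i → I r i ≡ I w i)))
relPseudoComplement-inversionSeq v w = v ⇝ w , ⇝-isRelPseudoComplement v w ,
  λ i → (trans (I-⇝ v w i) ∘ ⇝-≤ (toℕ i)) , (trans (I-⇝ v w i) ∘ ⇝-> (toℕ i))

pseudoComplement-oneLine : (v : S n) → ∃[ p ] (IsPseudoComplement p v × Avoids132 p × Avoids231 p ×
                                                oneLine p ≡ rlMinWord v)
pseudoComplement-oneLine v = v ⇝ e , p-pc , proj₁ p-avoids , proj₂ p-avoids ,
  oneLine-fromInversionSeq (RLMin? v) at-RLMin at-other
  where
  p-pc = ⇝-isRelPseudoComplement v e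
  p-avoids = Equivalence.to (Extremal⇔avoids (v ⇝ e)) (IsPseudoComplement⇒Extremal (v ⇝ e) v p-pc)
  at-RLMin : ∀ i → RLMin v i → RelPseudoComplementSeq v e i ≡ toℕ i
  at-RLMin i rlmin = ⇝-≤ (toℕ i) (subst (_≤ I e i) (sym (RLMin⇒I≡0 v rlmin)) z≤n)
  at-other : ∀ i → ¬ RLMin v i → RelPseudoComplementSeq v e i ≡ 0
  at-other i ¬rlmin = trans (⇝-> (toℕ i) e<v) (I-id i)
    where
    e<v : I e i < I v i
    e<v = subst (_< I v i) (sym (I-id i)) (ℕP.n≢0⇒n>0 (¬rlmin ∘ I≡0⇒RLMin v))

regular⇔avoids : (v : S n) → Regular v ⇔ (Avoids132 v × Avoids231 v)
regular⇔avoids v = mk⇔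
  (Equivalence.to (Extremal⇔avoids v) ∘ regular⇒Extremal)
  (Extremal⇒regular ∘ Equivalence.from (Extremal⇔avoids v))
  where
  regular⇒Extremal : Regular v → Extremal v
  regular⇒Extremal (p , q , _ , q-pc , q≈v) i =
    Sum.map (trans I-v≡I-q) (trans I-v≡I-q) (IsPseudoComplement⇒Extremal q p q-pc i)
    where
    I-v≡I-q = sym (I-cong q v q≈v i)
  Extremal⇒regular : Extremal v → Regular v
  Extremal⇒regular extremal =
    v ⇝ e , v , ⇝-isRelPseudoComplement v e , I⇒IsRelPseudoComplement v (v ⇝ e) e I-v , λ _ → refl
    where
    I-v : ∀ i → I v i ≡ RelPseudoComplementSeq (v ⇝ e) e i
    I-v i rewrite I-⇝ v e i | I-id i = sym (⇝0-involutive (toℕ i) (extremal i))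

theorem6p1 : (∀ {n} (v w : S n) → ∃[ r ] (IsRelPseudoComplement r v w ×
    (∀ i → (I v i ≤ I w i → I r i ≡ toℕ i) × (I w i < I v i → I r i ≡ I w i))))
    × (∀ {n} (v : S n) → ∃[ p ] (IsPseudoComplement p v × Avoids132 p × Avoids231 p ×
    oneLine p ≡ rlMinWord v))
    × (∀ {n} (v : S n) → Regular v ⇔ (Avoids132 v × Avoids231 v))
theorem6p1 = relPseudoComplement-inversionSeq , pseudoComplement-oneLine , regular⇔avoids
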